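{- Let $(x,y,k)$ be a good triplet. Then there exist $p,q \in \mathbb{N}$ such that $$|F(q,p,x,y)| < 8q + 1,$$ and moreover $q < x^{1/6}$ and $p < x^{2/3}+1$.
   Context: Here $\mathbb{N}=\{1,2,3,\dots\}$. A triple $(x,y,k)$ is a good triplet if $x,y \in \mathbb{N}$, $k = x^3 - y^2 \in \mathbb{Z}$, and $0 < |k| < \sqrt{x}$. The polynomials are $B(q,p,x) = p^2 - q^2x$, $C(q,p,x,y) = p^3 - 3pq^2x + 2q^3y$, and $F(q,p,x,y) = 4p\,C(q,p,x,y) - 3B(q,p,x)^2$. -}

module Defs where

open import Data.Nat using (ℕ; _≤_; _<_) renaming (_*_ to _*ℕ_; _^_ to _^ℕ_)
open import Data.Integer using (ℤ; +_; _-_; _*_; _+_; ∣_∣; 0ℤ)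
open import Data.Product using (_×_)
open import Data.Empty using (⊥)
open import Relation.Binary.PropositionalEquality using (_≡_)
open import Relation.Nullary using (¬_)

sq : ℤ → ℤ
sq a = a * a

cube : ℤ → ℤ
cube a = a * a * a

B : ℤ → ℤ → ℤ → ℤ
B q p x = sq p - sq q * x

C : ℤ → ℤ → ℤ → ℤ → ℤ
C q p x y = cube p - (+ 3) * p * sq q * x + (+ 2) * cube q * y

F : ℤ → ℤ → ℤ → ℤ → ℤ
F q p x y = (+ 4) * p * C q p x y - (+ 3) * sq (B q p x)

-- (x,y,k) is a good triplet: x,y ∈ ℕ = {1,2,...}, k = x^3 - y^2,
-- and 0 < |k| < √x, i.e. k ≠ 0 and |k|^2 < x (both sides nonnegative).
GoodTriplet : ℕ → ℕ → ℤ → Set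
GoodTriplet x y k =
  (1 ≤ x) × (1 ≤ y) ×
  (k ≡ + (x ^ℕ 3) - + (y ^ℕ 2)) ×
  (¬ (k ≡ 0ℤ)) ×
  (∣ k ∣ *ℕ ∣ k ∣ < x)

{-# OPTIONS --safe #-}

-- Write u = px − qy and k = x³ − y². Then
--   x⁴ F(q,p,x,y) = u³(u + 4qy) − k q² (4q²y² + 4qyu + 6u²) − 3q⁴k²,
-- so F is small when u is. Dirichlet's theorem (by mediants of Farey fractions) with
-- Q = ⌊x^(1/6)⌋ gives q ≤ Q with (Q + 1)|u| ≤ x, hence |u|⁶ ≤ x⁵. Together with |k|² < x and
-- y² ≤ x³ + |k| each term is at most of order q x⁴, and counting carefully gives
-- x⁴|F| < (8q + 1)x⁴ once x ≥ 17. The bound on p comes from (p − 1)x < qy.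
-- Below 17 a search finds only the triplet (2, 3, −1), where p = q = 1 works.

module Submission where

open import Defs
open import Data.Nat using (ℕ; zero; suc; _+_; _*_; _^_; _≤_; _<_; _∸_; _≤?_; _<?_; NonZero; >-nonZero; _/_; _%_; z≤n; s≤s)
open import Data.Nat.Properties
open import Data.Nat.DivMod using (m≡m%n+[m/n]*n; m%n<n; m≥n⇒m/n>0)
open import Data.Nat.Tactic.RingSolver
import Data.Integer as ℤ
open import Data.Integer using (ℤ; +_; ∣_∣; 0ℤ; _⊖_)
import Data.Integer.Properties as ℤ
import Data.Integer.Tactic.RingSolver as ℤ-Solver
open import Data.Fin using (Fin; toℕ; fromℕ<)
open import Data.Fin.Properties using (all?; toℕ-fromℕ<)
open import Data.List using (_∷_; [])
open import Data.Product using (Σ; _×_; _,_)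
open import Data.Sum using (_⊎_; inj₁; inj₂)
open import Relation.Binary.PropositionalEquality
open import Relation.Nullary using (Dec; yes; no; ¬_; ¬?)
open import Relation.Nullary.Decidable using (_×-dec_; _→-dec_; toWitness)
open import Relation.Nullary.Negation using (contradiction)
open import Relation.Unary using (Pred; Decidable)
open import Algebra.Properties.CommutativeSemiring.Exp +-*-commutativeSemiring using (^-distrib-*)

n^2≡n*n : ∀ n → n ^ 2 ≡ n * n
n^2≡n*n n = cong (n *_) (*-identityʳ n)

n^3≡n*n*n : ∀ n → n ^ 3 ≡ n * n * n
n^3≡n*n*n n = trans (cong (n *_) (n^2≡n*n n)) (sym (*-assoc n n n))

n^5≡n*n*n*n*n : ∀ n → n ^ 5 ≡ n * n * n * n * n
n^5≡n*n*n*n*n n = begin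
  n ^ 5                  ≡⟨ ^-distribˡ-+-* n 2 3 ⟩
  n ^ 2 * n ^ 3          ≡⟨ cong₂ _*_ (n^2≡n*n n) (n^3≡n*n*n n) ⟩
  n * n * (n * n * n)    ≡⟨ solve (n ∷ []) ⟩
  n * n * n * n * n      ∎
  where open ≡-Reasoning

n^6≡n³*n³ : ∀ n → n ^ 6 ≡ n * n * n * (n * n * n)
n^6≡n³*n³ n = trans (^-distribˡ-+-* n 3 3) (cong₂ _*_ (n^3≡n*n*n n) (n^3≡n*n*n n))

n≤n*n : ∀ n → n ≤ n * n
n≤n*n zero      = z≤n
n≤n*n n@(suc _) = m≤m*n n n

m*m≤n*n⇒m≤n : ∀ {m n} → m * m ≤ n * n → m ≤ n
m*m≤n*n⇒m≤n {m} {n} m²≤n² with m ≤? n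
... | yes m≤n = m≤n
... | no m≰n = contradiction m²≤n² (<⇒≱ (*-mono-< (≰⇒> m≰n) (≰⇒> m≰n)))

m*m<n*n⇒m<n : ∀ {m n} → m * m < n * n → m < n
m*m<n*n⇒m<n {m} {n} m²<n² with m <? n
... | yes m<n = m<n
... | no m≮n = contradiction m²<n² (≤⇒≯ (*-mono-≤ (≮⇒≥ m≮n) (≮⇒≥ m≮n)))

m+m≤n⇒m<n : ∀ {m n} → 0 < n → m + m ≤ n → m < n
m+m≤n⇒m<n {zero}  0<n _     = 0<n
m+m≤n⇒m<n {suc m} _   m+m≤n = <-≤-trans (m<m+n (suc m) (s≤s z≤n)) m+m≤n

m≤n+d : ∀ {m n d} → m ≡ n + d ⊎ n ≡ m + d → m ≤ n + d
m≤n+d (inj₁ m≡n+d)            = ≤-reflexive m≡n+d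
m≤n+d {m} {d = d} (inj₂ refl) = ≤-trans (m≤m+n m d) (m≤m+n (m + d) d)

∣i-j-k∣≤∣i∣+∣j∣+∣k∣ : ∀ i j k → ∣ i ℤ.- j ℤ.- k ∣ ≤ ∣ i ∣ + ∣ j ∣ + ∣ k ∣
∣i-j-k∣≤∣i∣+∣j∣+∣k∣ i j k = ≤-trans (ℤ.∣i-j∣≤∣i∣+∣j∣ (i ℤ.- j) k) (+-monoˡ-≤ ∣ k ∣ (ℤ.∣i-j∣≤∣i∣+∣j∣ i j))

∣i+j+k∣≤∣i∣+∣j∣+∣k∣ : ∀ i j k → ∣ i ℤ.+ j ℤ.+ k ∣ ≤ ∣ i ∣ + ∣ j ∣ + ∣ k ∣
∣i+j+k∣≤∣i∣+∣j∣+∣k∣ i j k = ≤-trans (ℤ.∣i+j∣≤∣i∣+∣j∣ (i ℤ.+ j) k) (+-monoˡ-≤ ∣ k ∣ (ℤ.∣i+j∣≤∣i∣+∣j∣ i j))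

∣i*j*k∣≡∣i∣*∣j∣*∣k∣ : ∀ i j k → ∣ i ℤ.* j ℤ.* k ∣ ≡ ∣ i ∣ * ∣ j ∣ * ∣ k ∣
∣i*j*k∣≡∣i∣*∣j∣*∣k∣ i j k = trans (ℤ.abs-* (i ℤ.* j) k) (cong (_* ∣ k ∣) (ℤ.abs-* i j))

∣i*j*k*l∣≡∣i∣*∣j∣*∣k∣*∣l∣ : ∀ i j k l → ∣ i ℤ.* j ℤ.* k ℤ.* l ∣ ≡ ∣ i ∣ * ∣ j ∣ * ∣ k ∣ * ∣ l ∣
∣i*j*k*l∣≡∣i∣*∣j∣*∣k∣*∣l∣ i j k l = trans (ℤ.abs-* (i ℤ.* j ℤ.* k) l) (cong (_* ∣ l ∣) (∣i*j*k∣≡∣i∣*∣j∣*∣k∣ i j k))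

∣+m-+n∣≡d : ∀ {m n d} → m ≡ n + d ⊎ n ≡ m + d → ∣ + m ℤ.- + n ∣ ≡ d
∣+m-+n∣≡d {n = n} {d} (inj₁ refl) = begin
  ∣ + (n + d) ℤ.- + n ∣  ≡⟨ cong ∣_∣ (ℤ.m-n≡m⊖n (n + d) n) ⟩
  ∣ (n + d) ⊖ n ∣        ≡⟨ ℤ.∣m⊖n∣≡∣n⊖m∣ (n + d) n ⟩
  ∣ n ⊖ (n + d) ∣        ≡⟨ ℤ.∣⊖∣-≤ (m≤m+n n d) ⟩
  n + d ∸ n              ≡⟨ m+n∸m≡n n d ⟩
  d                      ∎
  where open ≡-Reasoning
∣+m-+n∣≡d {m} {d = d} (inj₂ refl) =
  trans (cong ∣_∣ (ℤ.m-n≡m⊖n m (m + d))) (trans (ℤ.∣⊖∣-≤ (m≤m+n m d)) (m+n∸m≡n m d))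

n≤m+∣+m-+n∣ : ∀ m n → n ≤ m + ∣ + m ℤ.- + n ∣
n≤m+∣+m-+n∣ m n with ≤-total n m
... | inj₁ n≤m = ≤-trans n≤m (m≤m+n m ∣ + m ℤ.- + n ∣)
... | inj₂ m≤n = ≤-reflexive (sym (begin
  m + ∣ + m ℤ.- + n ∣  ≡⟨ cong (λ d → m + ∣ d ∣) (ℤ.m-n≡m⊖n m n) ⟩
  m + ∣ m ⊖ n ∣        ≡⟨ cong (_+_ m) (ℤ.∣⊖∣-≤ m≤n) ⟩
  m + (n ∸ m)          ≡⟨ m+[n∸m]≡n m≤n ⟩
  n                    ∎))
  where open ≡-Reasoning

m≤n+∣+m-+n∣ : ∀ m n → m ≤ n + ∣ + m ℤ.- + n ∣
m≤n+∣+m-+n∣ m n = subst (λ d → m ≤ n + d) (ℤ.∣i-j∣≡∣j-i∣ (+ n) (+ m)) (n≤m+∣+m-+n∣ n m)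

+[n^2]≡+n*+n : ∀ n → + (n ^ 2) ≡ + n ℤ.* + n
+[n^2]≡+n*+n n = trans (cong +_ (n^2≡n*n n)) (ℤ.pos-* n n)

+[n^3]≡+n*+n*+n : ∀ n → + (n ^ 3) ≡ + n ℤ.* + n ℤ.* + n
+[n^3]≡+n*+n*+n n = begin
  + (n ^ 3)              ≡⟨ cong +_ (n^3≡n*n*n n) ⟩
  + (n * n * n)          ≡⟨ ℤ.pos-* (n * n) n ⟩
  + (n * n) ℤ.* + n      ≡⟨ cong (ℤ._* + n) (ℤ.pos-* n n) ⟩
  + n ℤ.* + n ℤ.* + n    ∎
  where open ≡-Reasoning

-- The expansion of x⁴ F

Φ : ℤ → ℤ → ℤ → ℤ → ℤ
Φ u v q k = u ℤ.* u ℤ.* u ℤ.* (u ℤ.+ + 4 ℤ.* v)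
          ℤ.- k ℤ.* (q ℤ.* q) ℤ.* (+ 4 ℤ.* v ℤ.* v ℤ.+ + 4 ℤ.* v ℤ.* u ℤ.+ + 6 ℤ.* u ℤ.* u)
          ℤ.- + 3 ℤ.* (q ℤ.* q ℤ.* q ℤ.* q) ℤ.* (k ℤ.* k)

Φ⁺ : ℕ → ℕ → ℕ → ℕ → ℕ
Φ⁺ U v q K = U * U * U * (U + 4 * v)
           + K * (q * q) * (4 * v * v + 4 * v * U + 6 * U * U)
           + 3 * (q * q * q * q) * (K * K)

x⁴F≡Φ : ∀ p q x y →
  x ℤ.* x ℤ.* x ℤ.* x ℤ.* F q p x y ≡ Φ (p ℤ.* x ℤ.- q ℤ.* y) (q ℤ.* y) q (x ℤ.* x ℤ.* x ℤ.- y ℤ.* y)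
x⁴F≡Φ = expanded
  where
  -- F and Φ unfolded: the ring solver does not look through definitions.
  expanded : ∀ p q x y →
    x ℤ.* x ℤ.* x ℤ.* x ℤ.* (+ 4 ℤ.* p ℤ.* (p ℤ.* p ℤ.* p ℤ.- + 3 ℤ.* p ℤ.* (q ℤ.* q) ℤ.* x ℤ.+ + 2 ℤ.* (q ℤ.* q ℤ.* q) ℤ.* y)
                            ℤ.- + 3 ℤ.* ((p ℤ.* p ℤ.- q ℤ.* q ℤ.* x) ℤ.* (p ℤ.* p ℤ.- q ℤ.* q ℤ.* x)))
    ≡ (p ℤ.* x ℤ.- q ℤ.* y) ℤ.* (p ℤ.* x ℤ.- q ℤ.* y) ℤ.* (p ℤ.* x ℤ.- q ℤ.* y) ℤ.* ((p ℤ.* x ℤ.- q ℤ.* y) ℤ.+ + 4 ℤ.* (q ℤ.* y))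
      ℤ.- (x ℤ.* x ℤ.* x ℤ.- y ℤ.* y) ℤ.* (q ℤ.* q)
          ℤ.* (+ 4 ℤ.* (q ℤ.* y) ℤ.* (q ℤ.* y) ℤ.+ + 4 ℤ.* (q ℤ.* y) ℤ.* (p ℤ.* x ℤ.- q ℤ.* y) ℤ.+ + 6 ℤ.* (p ℤ.* x ℤ.- q ℤ.* y) ℤ.* (p ℤ.* x ℤ.- q ℤ.* y))
      ℤ.- + 3 ℤ.* (q ℤ.* q ℤ.* q ℤ.* q) ℤ.* ((x ℤ.* x ℤ.* x ℤ.- y ℤ.* y) ℤ.* (x ℤ.* x ℤ.* x ℤ.- y ℤ.* y))
  expanded = ℤ-Solver.solve-∀

∣Φ∣≤Φ⁺ : ∀ u v q k → ∣ Φ u (+ v) (+ q) k ∣ ≤ Φ⁺ (∣ u ∣) v q (∣ k ∣)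
∣Φ∣≤Φ⁺ u v q k = begin
  ∣ Φ u (+ v) (+ q) k ∣              ≤⟨ ∣i-j-k∣≤∣i∣+∣j∣+∣k∣ main mixed square ⟩
  ∣ main ∣ + ∣ mixed ∣ + ∣ square ∣  ≤⟨ +-mono-≤ (+-mono-≤ main-bound mixed-bound) (≤-reflexive square-abs) ⟩
  Φ⁺ (∣ u ∣) v q (∣ k ∣)             ∎
  where
  open ≤-Reasoning
  U = ∣ u ∣
  K = ∣ k ∣
  main = u ℤ.* u ℤ.* u ℤ.* (u ℤ.+ + 4 ℤ.* + v)
  inner = + 4 ℤ.* + v ℤ.* + v ℤ.+ + 4 ℤ.* + v ℤ.* u ℤ.+ + 6 ℤ.* u ℤ.* u
  mixed = k ℤ.* (+ q ℤ.* + q) ℤ.* inner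
  square = + 3 ℤ.* (+ q ℤ.* + q ℤ.* + q ℤ.* + q) ℤ.* (k ℤ.* k)
  main-bound : ∣ main ∣ ≤ U * U * U * (U + 4 * v)
  main-bound = begin
    ∣ main ∣                                     ≡⟨ ∣i*j*k*l∣≡∣i∣*∣j∣*∣k∣*∣l∣ u u u _ ⟩
    U * U * U * ∣ u ℤ.+ + 4 ℤ.* + v ∣            ≤⟨ *-monoʳ-≤ (U * U * U) (ℤ.∣i+j∣≤∣i∣+∣j∣ u _) ⟩
    U * U * U * (U + ∣ + 4 ℤ.* + v ∣)            ≡⟨ cong (λ w → U * U * U * (U + w)) (ℤ.abs-* (+ 4) (+ v)) ⟩
    U * U * U * (U + 4 * v)                      ∎
  inner-bound : ∣ inner ∣ ≤ 4 * v * v + 4 * v * U + 6 * U * U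
  inner-bound = begin
    ∣ inner ∣  ≤⟨ ∣i+j+k∣≤∣i∣+∣j∣+∣k∣ (+ 4 ℤ.* + v ℤ.* + v) (+ 4 ℤ.* + v ℤ.* u) (+ 6 ℤ.* u ℤ.* u) ⟩
    ∣ + 4 ℤ.* + v ℤ.* + v ∣ + ∣ + 4 ℤ.* + v ℤ.* u ∣ + ∣ + 6 ℤ.* u ℤ.* u ∣
      ≡⟨ cong₂ _+_ (cong₂ _+_ (∣i*j*k∣≡∣i∣*∣j∣*∣k∣ (+ 4) (+ v) (+ v)) (∣i*j*k∣≡∣i∣*∣j∣*∣k∣ (+ 4) (+ v) u))
                   (∣i*j*k∣≡∣i∣*∣j∣*∣k∣ (+ 6) u u) ⟩
    4 * v * v + 4 * v * U + 6 * U * U  ∎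
  mixed-bound : ∣ mixed ∣ ≤ K * (q * q) * (4 * v * v + 4 * v * U + 6 * U * U)
  mixed-bound = begin
    ∣ mixed ∣                        ≡⟨ ∣i*j*k∣≡∣i∣*∣j∣*∣k∣ k (+ q ℤ.* + q) inner ⟩
    K * ∣ + q ℤ.* + q ∣ * ∣ inner ∣  ≡⟨ cong (λ w → K * w * ∣ inner ∣) (ℤ.abs-* (+ q) (+ q)) ⟩
    K * (q * q) * ∣ inner ∣          ≤⟨ *-monoʳ-≤ (K * (q * q)) inner-bound ⟩
    K * (q * q) * (4 * v * v + 4 * v * U + 6 * U * U)  ∎
  square-abs : ∣ square ∣ ≡ 3 * (q * q * q * q) * (K * K)
  square-abs = trans (∣i*j*k∣≡∣i∣*∣j∣*∣k∣ (+ 3) (+ q ℤ.* + q ℤ.* + q ℤ.* + q) (k ℤ.* k))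
                     (cong₂ (λ a b → 3 * a * b) (∣i*j*k*l∣≡∣i∣*∣j∣*∣k∣*∣l∣ (+ q) (+ q) (+ q) (+ q)) (ℤ.abs-* k k))

x⁴∣F∣≤Φ⁺ : ∀ p q x y {U} → p * x ≡ q * y + U ⊎ q * y ≡ p * x + U →
  x * x * x * x * ∣ F (+ q) (+ p) (+ x) (+ y) ∣ ≤ Φ⁺ U (q * y) q (∣ + (x ^ 3) ℤ.- + (y ^ 2) ∣)
x⁴∣F∣≤Φ⁺ p q x y {U} distance = begin
  x * x * x * x * ∣ F q′ p′ x′ y′ ∣
    ≡⟨ cong (_* ∣ F q′ p′ x′ y′ ∣) (sym (∣i*j*k*l∣≡∣i∣*∣j∣*∣k∣*∣l∣ x′ x′ x′ x′)) ⟩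
  ∣ x′ ℤ.* x′ ℤ.* x′ ℤ.* x′ ∣ * ∣ F q′ p′ x′ y′ ∣
    ≡⟨ sym (ℤ.abs-* (x′ ℤ.* x′ ℤ.* x′ ℤ.* x′) (F q′ p′ x′ y′)) ⟩
  ∣ x′ ℤ.* x′ ℤ.* x′ ℤ.* x′ ℤ.* F q′ p′ x′ y′ ∣
    ≡⟨ cong ∣_∣ (x⁴F≡Φ p′ q′ x′ y′) ⟩
  ∣ Φ u (q′ ℤ.* y′) q′ (x′ ℤ.* x′ ℤ.* x′ ℤ.- y′ ℤ.* y′) ∣
    ≡⟨ cong₂ (λ v k → ∣ Φ u v q′ k ∣) (sym (ℤ.pos-* q y))
             (sym (cong₂ ℤ._-_ (+[n^3]≡+n*+n*+n x) (+[n^2]≡+n*+n y))) ⟩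
  ∣ Φ u (+ (q * y)) q′ k ∣
    ≤⟨ ∣Φ∣≤Φ⁺ u (q * y) q k ⟩
  Φ⁺ (∣ u ∣) (q * y) q (∣ k ∣)
    ≡⟨ cong (λ V → Φ⁺ V (q * y) q (∣ k ∣)) ∣u∣≡U ⟩
  Φ⁺ U (q * y) q (∣ k ∣)
    ∎
  where
  open ≤-Reasoning
  p′ = + p
  q′ = + q
  x′ = + x
  y′ = + y
  u = p′ ℤ.* x′ ℤ.- q′ ℤ.* y′
  k = + (x ^ 3) ℤ.- + (y ^ 2)
  ∣u∣≡U : ∣ u ∣ ≡ U
  ∣u∣≡U = trans (cong₂ (λ a b → ∣ a ℤ.- b ∣) (sym (ℤ.pos-* p x)) (sym (ℤ.pos-* q y))) (∣+m-+n∣≡d distance)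

-- Dirichlet approximation by Farey fractions

record FareyBracket (x y Q : ℕ) : Set where
  field
    p₁ q₁ p₂ q₂ : ℕ
    below      : p₁ * x ≤ q₁ * y
    above      : q₂ * y ≤ p₂ * x
    adjacent   : q₁ * p₂ ≡ p₁ * q₂ + 1
    1≤p₁       : 1 ≤ p₁
    1≤p₂       : 1 ≤ p₂
    1≤q₁       : 1 ≤ q₁
    1≤q₂       : 1 ≤ q₂
    q₁≤Q       : q₁ ≤ Q
    q₂≤Q       : q₂ ≤ Q

  denominators : ℕ
  denominators = q₁ + q₂

open FareyBracket

record DirichletApproximation (x y Q : ℕ) : Set where
  field
    p q U    : ℕ
    1≤p      : 1 ≤ p
    1≤q      : 1 ≤ q
    q≤Q      : q ≤ Q
    distance : p * x ≡ q * y + U ⊎ q * y ≡ p * x + U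
    small    : suc Q * U ≤ x

initial-bracket : ∀ {x y Q} .{{_ : NonZero x}} → 1 ≤ Q → x ≤ y → FareyBracket x y Q
initial-bracket {x} {y} 1≤Q x≤y = record
  { p₁ = y / x ; q₁ = 1 ; p₂ = suc (y / x) ; q₂ = 1
  ; below = begin
      y / x * x              ≤⟨ m≤n+m (y / x * x) (y % x) ⟩
      y % x + y / x * x      ≡⟨ sym (m≡m%n+[m/n]*n y x) ⟩
      y                      ≡⟨ sym (*-identityˡ y) ⟩
      1 * y                  ∎
  ; above = begin
      1 * y                  ≡⟨ *-identityˡ y ⟩
      y                      ≡⟨ m≡m%n+[m/n]*n y x ⟩
      y % x + y / x * x      ≤⟨ +-monoˡ-≤ (y / x * x) (<⇒≤ (m%n<n y x)) ⟩
      suc (y / x) * x        ∎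
  ; adjacent = unit-gap (y / x)
  ; 1≤p₁ = m≥n⇒m/n>0 x≤y ; 1≤p₂ = s≤s z≤n
  ; 1≤q₁ = s≤s z≤n ; 1≤q₂ = s≤s z≤n ; q₁≤Q = 1≤Q ; q₂≤Q = 1≤Q
  }
  where
  open ≤-Reasoning
  unit-gap : ∀ a → 1 * suc a ≡ a * 1 + 1
  unit-gap = solve-∀

mediant-adjacentʳ : ∀ p₁ q₁ p₂ q₂ → q₁ * p₂ ≡ p₁ * q₂ + 1 → q₁ * (p₁ + p₂) ≡ p₁ * (q₁ + q₂) + 1
mediant-adjacentʳ p₁ q₁ p₂ q₂ adj = begin
  q₁ * (p₁ + p₂)           ≡⟨ *-distribˡ-+ q₁ p₁ p₂ ⟩
  q₁ * p₁ + q₁ * p₂        ≡⟨ cong (_+_ (q₁ * p₁)) adj ⟩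
  q₁ * p₁ + (p₁ * q₂ + 1)  ≡⟨ regroup p₁ q₁ q₂ ⟩
  p₁ * (q₁ + q₂) + 1       ∎
  where
  open ≡-Reasoning
  regroup : ∀ p₁ q₁ q₂ → q₁ * p₁ + (p₁ * q₂ + 1) ≡ p₁ * (q₁ + q₂) + 1
  regroup = solve-∀

mediant-adjacentˡ : ∀ p₁ q₁ p₂ q₂ → q₁ * p₂ ≡ p₁ * q₂ + 1 → (q₁ + q₂) * p₂ ≡ (p₁ + p₂) * q₂ + 1
mediant-adjacentˡ p₁ q₁ p₂ q₂ adj = begin
  (q₁ + q₂) * p₂           ≡⟨ *-distribʳ-+ p₂ q₁ q₂ ⟩
  q₁ * p₂ + q₂ * p₂        ≡⟨ cong (_+ q₂ * p₂) adj ⟩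
  p₁ * q₂ + 1 + q₂ * p₂    ≡⟨ regroup p₁ p₂ q₂ ⟩
  (p₁ + p₂) * q₂ + 1       ∎
  where
  open ≡-Reasoning
  regroup : ∀ p₁ p₂ q₂ → p₁ * q₂ + 1 + q₂ * p₂ ≡ (p₁ + p₂) * q₂ + 1
  regroup = solve-∀

mediant-step : ∀ {x y Q} (b : FareyBracket x y Q) → denominators b ≤ Q →
               Σ (FareyBracket x y Q) λ b′ → denominators b < denominators b′
mediant-step {x} {y} b d≤Q with (q₁ b + q₂ b) * y ≤? (p₁ b + p₂ b) * x
... | yes mediant-above =
  record b { p₂ = p₁ b + p₂ b ; q₂ = q₁ b + q₂ b ; above = mediant-above
           ; adjacent = mediant-adjacentʳ (p₁ b) (q₁ b) (p₂ b) (q₂ b) (adjacent b)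
           ; 1≤p₂ = ≤-trans (1≤p₁ b) (m≤m+n (p₁ b) (p₂ b))
           ; 1≤q₂ = ≤-trans (1≤q₁ b) (m≤m+n (q₁ b) (q₂ b)) ; q₂≤Q = d≤Q } ,
  m<n+m (q₁ b + q₂ b) (1≤q₁ b)
... | no mediant-below =
  record b { p₁ = p₁ b + p₂ b ; q₁ = q₁ b + q₂ b ; below = <⇒≤ (≰⇒> mediant-below)
           ; adjacent = mediant-adjacentˡ (p₁ b) (q₁ b) (p₂ b) (q₂ b) (adjacent b)
           ; 1≤p₁ = ≤-trans (1≤p₁ b) (m≤m+n (p₁ b) (p₂ b))
           ; 1≤q₁ = ≤-trans (1≤q₁ b) (m≤m+n (q₁ b) (q₂ b)) ; q₁≤Q = d≤Q } ,
  m<m+n (q₁ b + q₂ b) (1≤q₂ b)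

exhaust : ∀ {x y Q} n (b : FareyBracket x y Q) → Q < n + denominators b →
          Σ (FareyBracket x y Q) λ b′ → Q < denominators b′
exhaust {Q = Q} n b Q<n+d with denominators b ≤? Q
... | no d≰Q = b , ≰⇒> d≰Q
exhaust zero b Q<d | yes d≤Q = contradiction d≤Q (<⇒≱ Q<d)
exhaust (suc n) b Q<n+d | yes d≤Q with mediant-step b d≤Q
... | b′ , d<d′ = exhaust n b′ (<-≤-trans Q<n+d (begin
  suc n + denominators b    ≡⟨ sym (+-suc n (denominators b)) ⟩
  n + suc (denominators b)  ≤⟨ +-monoʳ-≤ n d<d′ ⟩
  n + denominators b′       ∎))
  where open ≤-Reasoning

left-gap : ∀ {x y U} p₁ q₁ p₂ q₂ → q₁ * p₂ ≡ p₁ * q₂ + 1 → q₁ * y ≡ p₁ * x + U →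
           (q₁ + q₂) * y ≤ (p₁ + p₂) * x → (q₁ + q₂) * U ≤ x
left-gap {x} {y} {U} p₁ q₁ p₂ q₂ adj gap mediant-above = +-cancelˡ-≤ ((q₁ + q₂) * (p₁ * x)) _ _ (begin
  (q₁ + q₂) * (p₁ * x) + (q₁ + q₂) * U  ≡⟨ sym (*-distribˡ-+ (q₁ + q₂) (p₁ * x) U) ⟩
  (q₁ + q₂) * (p₁ * x + U)              ≡⟨ cong ((q₁ + q₂) *_) (sym gap) ⟩
  (q₁ + q₂) * (q₁ * y)                  ≡⟨ swap q₁ q₂ y ⟩
  q₁ * ((q₁ + q₂) * y)                  ≤⟨ *-monoʳ-≤ q₁ mediant-above ⟩
  q₁ * ((p₁ + p₂) * x)                  ≡⟨ expand p₁ q₁ p₂ x ⟩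
  (q₁ * p₁ + q₁ * p₂) * x               ≡⟨ cong (λ t → (q₁ * p₁ + t) * x) adj ⟩
  (q₁ * p₁ + (p₁ * q₂ + 1)) * x         ≡⟨ collect p₁ q₁ q₂ x ⟩
  (q₁ + q₂) * (p₁ * x) + x              ∎)
  where
  open ≤-Reasoning
  swap : ∀ q₁ q₂ y → (q₁ + q₂) * (q₁ * y) ≡ q₁ * ((q₁ + q₂) * y)
  swap = solve-∀
  expand : ∀ p₁ q₁ p₂ x → q₁ * ((p₁ + p₂) * x) ≡ (q₁ * p₁ + q₁ * p₂) * x
  expand = solve-∀
  collect : ∀ p₁ q₁ q₂ x → (q₁ * p₁ + (p₁ * q₂ + 1)) * x ≡ (q₁ + q₂) * (p₁ * x) + x
  collect = solve-∀

right-gap : ∀ {x y U} p₁ q₁ p₂ q₂ → q₁ * p₂ ≡ p₁ * q₂ + 1 → p₂ * x ≡ q₂ * y + U →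
            (p₁ + p₂) * x ≤ (q₁ + q₂) * y → (q₁ + q₂) * U ≤ x
right-gap {x} {y} {U} p₁ q₁ p₂ q₂ adj gap mediant-below = +-cancelˡ-≤ ((q₁ + q₂) * (q₂ * y)) _ _ (begin
  (q₁ + q₂) * (q₂ * y) + (q₁ + q₂) * U  ≡⟨ sym (*-distribˡ-+ (q₁ + q₂) (q₂ * y) U) ⟩
  (q₁ + q₂) * (q₂ * y + U)              ≡⟨ cong ((q₁ + q₂) *_) (sym gap) ⟩
  (q₁ + q₂) * (p₂ * x)                  ≡⟨ expand q₁ p₂ q₂ x ⟩
  (q₁ * p₂ + q₂ * p₂) * x               ≡⟨ cong (λ t → (t + q₂ * p₂) * x) adj ⟩
  (p₁ * q₂ + 1 + q₂ * p₂) * x           ≡⟨ collect p₁ p₂ q₂ x ⟩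
  q₂ * ((p₁ + p₂) * x) + x              ≤⟨ +-monoˡ-≤ x (*-monoʳ-≤ q₂ mediant-below) ⟩
  q₂ * ((q₁ + q₂) * y) + x              ≡⟨ cong (_+ x) (swap q₁ q₂ y) ⟩
  (q₁ + q₂) * (q₂ * y) + x              ∎)
  where
  open ≤-Reasoning
  expand : ∀ q₁ p₂ q₂ x → (q₁ + q₂) * (p₂ * x) ≡ (q₁ * p₂ + q₂ * p₂) * x
  expand = solve-∀
  collect : ∀ p₁ p₂ q₂ x → (p₁ * q₂ + 1 + q₂ * p₂) * x ≡ q₂ * ((p₁ + p₂) * x) + x
  collect = solve-∀
  swap : ∀ q₁ q₂ y → q₂ * ((q₁ + q₂) * y) ≡ (q₁ + q₂) * (q₂ * y)
  swap = solve-∀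

bracket-endpoint : ∀ {x y Q} (b : FareyBracket x y Q) → Q < denominators b → DirichletApproximation x y Q
bracket-endpoint {x} {y} b Q<d with (q₁ b + q₂ b) * y ≤? (p₁ b + p₂ b) * x
... | yes mediant-above = record
  { p = p₁ b ; q = q₁ b ; U = U ; 1≤p = 1≤p₁ b ; 1≤q = 1≤q₁ b ; q≤Q = q₁≤Q b
  ; distance = inj₂ gap
  ; small = ≤-trans (*-monoˡ-≤ U Q<d) (left-gap (p₁ b) (q₁ b) (p₂ b) (q₂ b) (adjacent b) gap mediant-above) }
  where
  U = q₁ b * y ∸ p₁ b * x
  gap : q₁ b * y ≡ p₁ b * x + U
  gap = sym (m+[n∸m]≡n (below b))
... | no mediant-below = record
  { p = p₂ b ; q = q₂ b ; U = U ; 1≤p = 1≤p₂ b ; 1≤q = 1≤q₂ b ; q≤Q = q₂≤Q b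
  ; distance = inj₁ gap
  ; small = ≤-trans (*-monoˡ-≤ U Q<d) (right-gap (p₁ b) (q₁ b) (p₂ b) (q₂ b) (adjacent b) gap (<⇒≤ (≰⇒> mediant-below))) }
  where
  U = p₂ b * x ∸ q₂ b * y
  gap : p₂ b * x ≡ q₂ b * y + U
  gap = sym (m+[n∸m]≡n (above b))

dirichlet : ∀ {x y Q} .{{_ : NonZero x}} → 1 ≤ Q → x ≤ y → DirichletApproximation x y Q
dirichlet {Q = Q} 1≤Q x≤y with exhaust Q (initial-bracket 1≤Q x≤y) (m<m+n Q (s≤s z≤n))
... | b , Q<d = bracket-endpoint b Q<d

-- Integer sixth roots

last-before-failure : ∀ {ℓ} {P : Pred ℕ ℓ} → Decidable P → ∀ m {n} → P n → ¬ P (m + n) →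
                      Σ ℕ λ k → n ≤ k × P k × ¬ P (suc k)
last-before-failure P? zero Pn ¬Pn = contradiction Pn ¬Pn
last-before-failure {P = P} P? (suc m) {n} Pn ¬P[1+m+n] with P? (suc n)
... | no ¬P[1+n] = n , ≤-refl , Pn , ¬P[1+n]
... | yes P[1+n] with last-before-failure P? m P[1+n] (subst (λ i → ¬ P i) (sym (+-suc m n)) ¬P[1+m+n])
...   | k , 1+n≤k , Pk , ¬P[1+k] = k , <⇒≤ 1+n≤k , Pk , ¬P[1+k]

sixth-root : ∀ x → 1 < x → Σ ℕ λ Q → 1 ≤ Q × Q ^ 6 < x × x ≤ suc Q ^ 6
sixth-root x 1<x =
  let Q , 1≤Q , Q⁶<x , [1+Q]⁶≮x = last-before-failure (λ n → n ^ 6 <? x) (x ∸ 1) {1} 1<x x^6≮x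
  in  Q , 1≤Q , Q⁶<x , ≮⇒≥ [1+Q]⁶≮x
  where
  open ≤-Reasoning
  x^6≮x : ¬ (x ∸ 1 + 1) ^ 6 < x
  x^6≮x rewrite m∸n+n≡m (<⇒≤ 1<x) = ≤⇒≯ (begin
    x      ≡⟨ sym (*-identityʳ x) ⟩
    x ^ 1  ≤⟨ ^-monoʳ-≤ x {{>-nonZero (<⇒≤ 1<x)}} (s≤s (z≤n {5})) ⟩
    x ^ 6  ∎)

-- Size estimates

16U⁴≤x⁴ : ∀ x U → U + U ≤ x → 16 * (U * U * U * U) ≤ x * x * x * x
16U⁴≤x⁴ x U 2U≤x = begin
  16 * (U * U * U * U)                   ≡⟨ solve (U ∷ []) ⟩
  (U + U) * (U + U) * (U + U) * (U + U)  ≤⟨ *-mono-≤ (*-mono-≤ (*-mono-≤ 2U≤x 2U≤x) 2U≤x) 2U≤x ⟩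
  x * x * x * x                          ∎
  where open ≤-Reasoning

4U²≤x² : ∀ x U → U + U ≤ x → 4 * (U * U) ≤ x * x
4U²≤x² x U 2U≤x = begin
  4 * (U * U)        ≡⟨ solve (U ∷ []) ⟩
  (U + U) * (U + U)  ≤⟨ *-mono-≤ 2U≤x 2U≤x ⟩
  x * x              ∎
  where open ≤-Reasoning

yU³≤x⁴+x² : ∀ x y U → y * y ≤ x * x * x + x → U * U * U * (U * U * U) ≤ x * x * x * x * x →
            y * (U * U * U) ≤ x * x * x * x + x * x
yU³≤x⁴+x² x y U y²≤x³+x U⁶≤x⁵ = m*m≤n*n⇒m≤n (begin
  y * (U * U * U) * (y * (U * U * U))                    ≡⟨ solve (y ∷ U ∷ []) ⟩
  y * y * (U * U * U * (U * U * U))                      ≤⟨ *-mono-≤ y²≤x³+x U⁶≤x⁵ ⟩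
  (x * x * x + x) * (x * x * x * x * x)                  ≤⟨ m≤m+n _ (x * x * x * x * x * x + x * x * x * x) ⟩
  (x * x * x + x) * (x * x * x * x * x) + (x * x * x * x * x * x + x * x * x * x)
                                                         ≡⟨ solve (x ∷ []) ⟩
  (x * x * x * x + x * x) * (x * x * x * x + x * x)      ∎)
  where open ≤-Reasoning

16x⁴[x³+x]≤x⁸ : ∀ x → 17 ≤ x → 16 * (x * x) * (x * x * x + x) * (x * x) ≤ x * x * x * x * (x * x * x * x)
16x⁴[x³+x]≤x⁸ x 17≤x = begin
  16 * (x * x) * (x * x * x + x) * (x * x)                  ≡⟨ solve (x ∷ []) ⟩
  16 * (x * x * x * x * x * x * x) + 16 * (x * x * x * x * x)
    ≤⟨ +-monoʳ-≤ (16 * (x * x * x * x * x * x * x)) (*-monoˡ-≤ (x * x * x * x * x) 16≤x²) ⟩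
  16 * (x * x * x * x * x * x * x) + x * x * (x * x * x * x * x)
                                                            ≡⟨ solve (x ∷ []) ⟩
  17 * (x * x * x * x * x * x * x)                          ≤⟨ *-monoˡ-≤ (x * x * x * x * x * x * x) 17≤x ⟩
  x * (x * x * x * x * x * x * x)                           ≡⟨ solve (x ∷ []) ⟩
  x * x * x * x * (x * x * x * x)                           ∎
  where
  open ≤-Reasoning
  4≤x : 4 ≤ x
  4≤x = ≤-trans (m≤m+n 4 13) 17≤x
  16≤x² : 16 ≤ x * x
  16≤x² = *-mono-≤ 4≤x 4≤x

8MyU≤x⁴ : ∀ x y M U → 17 ≤ x → M ≤ x → y * y ≤ x * x * x + x → U + U ≤ x → 8 * (M * y * U) ≤ x * x * x * x
8MyU≤x⁴ x y M U 17≤x M≤x y²≤x³+x 2U≤x = m*m≤n*n⇒m≤n (begin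
  8 * (M * y * U) * (8 * (M * y * U))               ≡⟨ solve (M ∷ y ∷ U ∷ []) ⟩
  16 * (M * M) * (y * y) * ((U + U) * (U + U))      ≤⟨ *-mono-≤ (*-mono-≤ (*-monoʳ-≤ 16 (*-mono-≤ M≤x M≤x)) y²≤x³+x)
                                                                (*-mono-≤ 2U≤x 2U≤x) ⟩
  16 * (x * x) * (x * x * x + x) * (x * x)          ≤⟨ 16x⁴[x³+x]≤x⁸ x 17≤x ⟩
  x * x * x * x * (x * x * x * x)                   ∎)
  where open ≤-Reasoning

My²+[x³+x]≤x[x³+x] : ∀ x y M → M < x → y * y ≤ x * x * x + x →
                      M * (y * y) + (x * x * x + x) ≤ x * (x * x * x + x)
My²+[x³+x]≤x[x³+x] x y M M<x y²≤x³+x = begin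
  M * (y * y) + (x * x * x + x)                ≤⟨ +-monoˡ-≤ (x * x * x + x) (*-monoʳ-≤ M y²≤x³+x) ⟩
  M * (x * x * x + x) + (x * x * x + x)        ≡⟨ +-comm (M * (x * x * x + x)) (x * x * x + x) ⟩
  suc M * (x * x * x + x)                      ≤⟨ *-monoˡ-≤ (x * x * x + x) M<x ⟩
  x * (x * x * x + x)                          ∎
  where open ≤-Reasoning

main-term-bound : ∀ x y q U → U + U ≤ x → y * y ≤ x * x * x + x → U * U * U * (U * U * U) ≤ x * x * x * x * x →
                  16 * (U * U * U * (U + 4 * (q * y))) ≤ x * x * x * x + 64 * q * (x * x * x * x + x * x)
main-term-bound x y q U 2U≤x y²≤x³+x U⁶≤x⁵ = begin
  16 * (U * U * U * (U + 4 * (q * y)))                ≡⟨ solve (U ∷ q ∷ y ∷ []) ⟩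
  16 * (U * U * U * U) + 64 * q * (y * (U * U * U))   ≤⟨ +-mono-≤ (16U⁴≤x⁴ x U 2U≤x) (*-monoʳ-≤ (64 * q) (yU³≤x⁴+x² x y U y²≤x³+x U⁶≤x⁵)) ⟩
  x * x * x * x + 64 * q * (x * x * x * x + x * x)    ∎
  where open ≤-Reasoning

mixed-term-bound : ∀ x y q K U → 17 ≤ x → 1 ≤ q → q * q * q * K ≤ x → U + U ≤ x → y * y ≤ x * x * x + x →
  16 * (K * (q * q) * (4 * (q * y) * (q * y) + 4 * (q * y) * U + 6 * U * U))
    ≤ 64 * q * (q * q * q * K * (y * y)) + 8 * (x * x * x * x) + 24 * (x * (x * x))
mixed-term-bound x y q K U 17≤x 1≤q M≤x 2U≤x y²≤x³+x = begin
  16 * (K * (q * q) * (4 * (q * y) * (q * y) + 4 * (q * y) * U + 6 * U * U))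
    ≡⟨ solve (K ∷ q ∷ y ∷ U ∷ []) ⟩
  64 * q * (q * q * q * K * (y * y)) + 8 * (8 * (q * q * q * K * y * U)) + 24 * (q * q * K * (4 * (U * U)))
    ≤⟨ +-mono-≤ (+-monoʳ-≤ (64 * q * (q * q * q * K * (y * y))) (*-monoʳ-≤ 8 (8MyU≤x⁴ x y (q * q * q * K) U 17≤x M≤x y²≤x³+x 2U≤x)))
                (*-monoʳ-≤ 24 (*-mono-≤ q²K≤x (4U²≤x² x U 2U≤x))) ⟩
  64 * q * (q * q * q * K * (y * y)) + 8 * (x * x * x * x) + 24 * (x * (x * x))
    ∎
  where
  open ≤-Reasoning
  q²K≤x : q * q * K ≤ x
  q²K≤x = begin
    q * q * K        ≤⟨ m≤n*m (q * q * K) q {{>-nonZero 1≤q}} ⟩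
    q * (q * q * K)  ≡⟨ solve (q ∷ K ∷ []) ⟩
    q * q * q * K    ≤⟨ M≤x ⟩
    x                ∎

square-term-bound : ∀ x q K → q * q * q * K ≤ x → K ≤ x → 16 * (3 * (q * q * q * q) * (K * K)) ≤ 48 * q * (x * x)
square-term-bound x q K M≤x K≤x = begin
  16 * (3 * (q * q * q * q) * (K * K))  ≡⟨ solve (q ∷ K ∷ []) ⟩
  48 * q * (q * q * q * K * K)          ≤⟨ *-monoʳ-≤ (48 * q) (*-mono-≤ M≤x K≤x) ⟩
  48 * q * (x * x)                      ∎
  where open ≤-Reasoning

x⁴-dominates : ∀ x q → 4 ≤ x →
  x * x * x * x + 64 * q * (x * x * x * x + x * x) + 64 * q * (x * (x * x * x + x))
    + 8 * (x * x * x * x) + 24 * (x * x * x) + 48 * q * (x * x)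
  < 16 * ((8 * q + 1) * (x * x * x * x)) + 64 * q * (x * x * x + x)
x⁴-dominates x q 4≤x = begin-strict
  x * x * x * x + 64 * q * (x * x * x * x + x * x) + 64 * q * (x * (x * x * x + x))
    + 8 * (x * x * x * x) + 24 * (x * x * x) + 48 * q * (x * x)
      ≡⟨ solve (x ∷ q ∷ []) ⟩
  9 * (x * x * x * x) + 128 * q * (x * x * x * x) + q * (x * x) * 176 + x * x * x * 24
      ≤⟨ +-mono-≤ (+-monoʳ-≤ (9 * (x * x * x * x) + 128 * q * (x * x * x * x)) (*-monoʳ-≤ (q * (x * x)) 176≤64x))
                  (*-monoʳ-≤ (x * x * x) 24≤6x) ⟩
  9 * (x * x * x * x) + 128 * q * (x * x * x * x) + q * (x * x) * (64 * x) + x * x * x * (6 * x)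
      <⟨ m<m+n _ 0<x⁴+64qx ⟩
  9 * (x * x * x * x) + 128 * q * (x * x * x * x) + q * (x * x) * (64 * x) + x * x * x * (6 * x) + (x * x * x * x + 64 * q * x)
      ≡⟨ solve (x ∷ q ∷ []) ⟩
  16 * ((8 * q + 1) * (x * x * x * x)) + 64 * q * (x * x * x + x)
      ∎
  where
  open ≤-Reasoning
  176≤64x : 176 ≤ 64 * x
  176≤64x = ≤-trans (m≤m+n 176 80) (*-monoʳ-≤ 64 4≤x)
  24≤6x : 24 ≤ 6 * x
  24≤6x = *-monoʳ-≤ 6 4≤x
  0<x⁴+64qx : 0 < x * x * x * x + 64 * q * x
  0<x⁴+64qx = ≤-trans (*-mono-≤ (*-mono-≤ (*-mono-≤ 0<x 0<x) 0<x) 0<x) (m≤m+n (x * x * x * x) (64 * q * x))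
    where
    0<x : 0 < x
    0<x = ≤-trans (s≤s z≤n) 4≤x

-- The extra 64q(x³ + x) on both sides lets the strict bound q³K < x, used in the form
-- q³K y² + (x³ + x) ≤ x(x³ + x), absorb the terms of order q x² without truncated subtraction.
Φ⁺-bound : ∀ x y q K U → 17 ≤ x → 1 ≤ q → K ≤ x → q * q * q * K < x → U + U ≤ x →
           U * U * U * (U * U * U) ≤ x * x * x * x * x → y * y ≤ x * x * x + x →
           Φ⁺ U (q * y) q K < (8 * q + 1) * (x * x * x * x)
Φ⁺-bound x y q K U 17≤x 1≤q K≤x M<x 2U≤x U⁶≤x⁵ y²≤x³+x =
  *-cancelˡ-< 16 _ _ (+-cancelʳ-< _ _ _ (begin-strict
    16 * Φ⁺ U (q * y) q K + 64 * q * (x * x * x + x)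
      ≡⟨ distribute main mixed square (64 * q * (x * x * x + x)) ⟩
    16 * main + 16 * mixed + 16 * square + 64 * q * (x * x * x + x)
      ≤⟨ +-monoˡ-≤ (64 * q * (x * x * x + x))
           (+-mono-≤ (+-mono-≤ (main-term-bound x y q U 2U≤x y²≤x³+x U⁶≤x⁵)
                                (mixed-term-bound x y q K U 17≤x 1≤q (<⇒≤ M<x) 2U≤x y²≤x³+x))
                     (square-term-bound x q K (<⇒≤ M<x) K≤x)) ⟩
    x * x * x * x + 64 * q * (x * x * x * x + x * x)
      + (64 * q * (q * q * q * K * (y * y)) + 8 * (x * x * x * x) + 24 * (x * (x * x)))
      + 48 * q * (x * x) + 64 * q * (x * x * x + x)
      ≡⟨ solve (x ∷ y ∷ q ∷ K ∷ []) ⟩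
    x * x * x * x + 64 * q * (x * x * x * x + x * x) + 64 * q * (q * q * q * K * (y * y) + (x * x * x + x))
      + 8 * (x * x * x * x) + 24 * (x * x * x) + 48 * q * (x * x)
      ≤⟨ +-monoˡ-≤ (48 * q * (x * x)) (+-monoˡ-≤ (24 * (x * x * x)) (+-monoˡ-≤ (8 * (x * x * x * x))
           (+-monoʳ-≤ (x * x * x * x + 64 * q * (x * x * x * x + x * x))
             (*-monoʳ-≤ (64 * q) (My²+[x³+x]≤x[x³+x] x y (q * q * q * K) M<x y²≤x³+x))))) ⟩
    x * x * x * x + 64 * q * (x * x * x * x + x * x) + 64 * q * (x * (x * x * x + x))
      + 8 * (x * x * x * x) + 24 * (x * x * x) + 48 * q * (x * x)
      <⟨ x⁴-dominates x q (≤-trans (m≤m+n 4 13) 17≤x) ⟩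
    16 * ((8 * q + 1) * (x * x * x * x)) + 64 * q * (x * x * x + x)
      ∎))
  where
  open ≤-Reasoning
  main = U * U * U * (U + 4 * (q * y))
  mixed = K * (q * q) * (4 * (q * y) * (q * y) + 4 * (q * y) * U + 6 * U * U)
  square = 3 * (q * q * q * q) * (K * K)
  distribute : ∀ a b c d → 16 * (a + b + c) + d ≡ 16 * a + 16 * b + 16 * c + d
  distribute = solve-∀

∣F∣<8q+1 : ∀ p q x y U → 17 ≤ x → 1 ≤ q → let K = ∣ + (x ^ 3) ℤ.- + (y ^ 2) ∣ in
  K < x → q * q * q * K < x → U + U ≤ x → U * U * U * (U * U * U) ≤ x * x * x * x * x →
  y * y ≤ x * x * x + x → p * x ≡ q * y + U ⊎ q * y ≡ p * x + U →
  ∣ F (+ q) (+ p) (+ x) (+ y) ∣ < 8 * q + 1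
∣F∣<8q+1 p q x y U 17≤x 1≤q K<x M<x 2U≤x U⁶≤x⁵ y²≤x³+x distance = *-cancelˡ-< (x * x * x * x) _ _ (begin-strict
  x * x * x * x * ∣ F (+ q) (+ p) (+ x) (+ y) ∣   ≤⟨ x⁴∣F∣≤Φ⁺ p q x y distance ⟩
  Φ⁺ U (q * y) q (∣ + (x ^ 3) ℤ.- + (y ^ 2) ∣)     <⟨ Φ⁺-bound x y q _ U 17≤x 1≤q (<⇒≤ K<x) M<x 2U≤x U⁶≤x⁵ y²≤x³+x ⟩
  (8 * q + 1) * (x * x * x * x)                   ≡⟨ *-comm (8 * q + 1) (x * x * x * x) ⟩
  x * x * x * x * (8 * q + 1)                     ∎)
  where open ≤-Reasoning

s[x³+s]³<x¹⁰ : ∀ s → s * (suc s ^ 3 + s) ^ 3 < suc s ^ 4 * suc s ^ 6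
s[x³+s]³<x¹⁰ s = subst (s * (suc s ^ 3 + s) ^ 3 <_) (expansion s) (m<m+n (s * (suc s ^ 3 + s) ^ 3) (s≤s z≤n))
  where
  -- The powers are written out as `_^_` computes them: the ring solver does not handle `_^_`.
  expansion : ∀ s →
    let x = suc s ; z = x * (x * (x * 1)) + s in
    s * (z * (z * (z * 1))) + suc (s * (9 + s * (33 + s * (63 + s * (71 + s * (57 + s * (36 + s * (18 + s * (6 + s)))))))))
      ≡ x * (x * (x * (x * 1))) * (x * (x * (x * (x * (x * (x * 1))))))
  expansion = solve-∀

P³<x² : ∀ {x P q y U K} → q ^ 6 < x → K < x → y ^ 2 ≤ x ^ 3 + K → U < x → suc P * x ≤ q * y + U →
        P ^ 3 < x ^ 2
P³<x² {suc s} {P} {q} {y} {U} q⁶<x K<x y²≤x³+K U<x [1+P]x≤qy+U =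
  m*m<n*n⇒m<n (subst₂ _<_ (^-distribˡ-+-* P 3 3) (^-distribˡ-+-* x 2 2) P⁶<x⁴)
  where
  open ≤-Reasoning
  x = suc s
  Px<qy : P * x < q * y
  Px<qy = +-cancelʳ-< x (P * x) (q * y) (begin-strict
    P * x + x  ≡⟨ +-comm (P * x) x ⟩
    suc P * x  ≤⟨ [1+P]x≤qy+U ⟩
    q * y + U  <⟨ +-monoʳ-< (q * y) U<x ⟩
    q * y + x  ∎)
  P⁶<x⁴ : P ^ 6 < x ^ 4
  P⁶<x⁴ = *-cancelʳ-< (x ^ 6) (P ^ 6) (x ^ 4) (begin-strict
    P ^ 6 * x ^ 6        ≡⟨ sym (^-distrib-* P x 6) ⟩
    (P * x) ^ 6          <⟨ ^-monoˡ-< 6 Px<qy ⟩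
    (q * y) ^ 6          ≡⟨ ^-distrib-* q y 6 ⟩
    q ^ 6 * y ^ 6        ≡⟨ cong (q ^ 6 *_) (sym (^-*-assoc y 2 3)) ⟩
    q ^ 6 * (y ^ 2) ^ 3  ≤⟨ *-mono-≤ (≤-pred q⁶<x) (^-monoˡ-≤ 3 (≤-trans y²≤x³+K (+-monoʳ-≤ (x ^ 3) (≤-pred K<x)))) ⟩
    s * (x ^ 3 + s) ^ 3  <⟨ s[x³+s]³<x¹⁰ s ⟩
    x ^ 4 * x ^ 6        ∎)

U³U³≤x⁵ : ∀ {x Q U} .{{_ : NonZero x}} → x ≤ suc Q ^ 6 → suc Q * U ≤ x → U * U * U * (U * U * U) ≤ x * x * x * x * x
U³U³≤x⁵ {x} {Q} {U} x≤[1+Q]⁶ [1+Q]U≤x = *-cancelˡ-≤ x (begin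
  x * (U * U * U * (U * U * U))         ≤⟨ *-monoˡ-≤ (U * U * U * (U * U * U)) x≤[1+Q]⁶ ⟩
  suc Q ^ 6 * (U * U * U * (U * U * U)) ≡⟨ cong (suc Q ^ 6 *_) (sym (n^6≡n³*n³ U)) ⟩
  suc Q ^ 6 * U ^ 6                     ≡⟨ sym (^-distrib-* (suc Q) U 6) ⟩
  (suc Q * U) ^ 6                       ≤⟨ ^-monoˡ-≤ 6 [1+Q]U≤x ⟩
  x * x ^ 5                             ≡⟨ cong (x *_) (n^5≡n*n*n*n*n x) ⟩
  x * (x * x * x * x * x)               ∎)
  where open ≤-Reasoning

x³≤y²+K⇒x≤y : ∀ {x y K} → K < x → x ^ 3 ≤ y ^ 2 + K → x ≤ y
x³≤y²+K⇒x≤y {x} {y} {K} K<x x³≤y²+K = ≮⇒≥ λ y<x → <⇒≱ (begin-strict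
  y ^ 2 + K    ≡⟨ cong (_+ K) (n^2≡n*n y) ⟩
  y * y + K    <⟨ +-mono-≤-< (*-monoʳ-≤ y (<⇒≤ y<x)) K<x ⟩
  y * x + x    ≡⟨ +-comm (y * x) x ⟩
  suc y * x    ≤⟨ *-monoˡ-≤ x y<x ⟩
  x * x        ≤⟨ m≤m*n (x * x) x {{>-nonZero (≤-<-trans z≤n K<x)}} ⟩
  x * x * x    ≡⟨ sym (n^3≡n*n*n x) ⟩
  x ^ 3        ∎) x³≤y²+K
  where open ≤-Reasoning

GoodApproximation : ℕ → ℕ → Set
GoodApproximation x y = Σ ℕ λ p → Σ ℕ λ q →
  (1 ≤ p) × (1 ≤ q) × (∣ F (+ q) (+ p) (+ x) (+ y) ∣ < 8 * q + 1) × (q ^ 6 < x) × ((p ∸ 1) ^ 3 < x ^ 2)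

good-approximation : ∀ {x y Q} → 17 ≤ x → ∣ + (x ^ 3) ℤ.- + (y ^ 2) ∣ * ∣ + (x ^ 3) ℤ.- + (y ^ 2) ∣ < x →
                     Q ^ 6 < x → x ≤ suc Q ^ 6 → DirichletApproximation x y Q → GoodApproximation x y
good-approximation {x} {y} {Q} 17≤x K²<x Q⁶<x x≤[1+Q]⁶
  record { p = suc P ; q = q ; U = U ; 1≤q = 1≤q ; q≤Q = q≤Q ; distance = distance ; small = small } =
  suc P , q , s≤s z≤n , 1≤q ,
  ∣F∣<8q+1 (suc P) q x y U 17≤x 1≤q K<x M<x 2U≤x (U³U³≤x⁵ {Q = Q} {U} {{x≢0}} x≤[1+Q]⁶ small) y²≤x³+x distance ,
  q⁶<x , P³<x² {P = P} {q} {y} {U} q⁶<x K<x (n≤m+∣+m-+n∣ (x ^ 3) (y ^ 2)) U<x (m≤n+d distance)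
  where
  open ≤-Reasoning
  K = ∣ + (x ^ 3) ℤ.- + (y ^ 2) ∣
  x≢0 : NonZero x
  x≢0 = >-nonZero (≤-trans (s≤s z≤n) 17≤x)
  K<x : K < x
  K<x = ≤-<-trans (n≤n*n K) K²<x
  q⁶<x : q ^ 6 < x
  q⁶<x = ≤-<-trans (^-monoˡ-≤ 6 q≤Q) Q⁶<x
  M<x : q * q * q * K < x
  M<x = m*m<n*n⇒m<n (begin-strict
    q * q * q * K * (q * q * q * K)    ≡⟨ regroup q K ⟩
    q * q * q * (q * q * q) * (K * K)  ≡⟨ cong (_* (K * K)) (sym (n^6≡n³*n³ q)) ⟩
    q ^ 6 * (K * K)                    <⟨ *-mono-< q⁶<x K²<x ⟩
    x * x                              ∎)
    where
    regroup : ∀ q K → q * q * q * K * (q * q * q * K) ≡ q * q * q * (q * q * q) * (K * K)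
    regroup = solve-∀
  2U≤x : U + U ≤ x
  2U≤x = begin
    U + U      ≡⟨ cong (_+_ U) (sym (+-identityʳ U)) ⟩
    2 * U      ≤⟨ *-monoˡ-≤ U (s≤s (≤-trans 1≤q q≤Q)) ⟩
    suc Q * U  ≤⟨ small ⟩
    x          ∎
  U<x : U < x
  U<x = m+m≤n⇒m<n (≤-trans (s≤s z≤n) 17≤x) 2U≤x
  y²≤x³+x : y * y ≤ x * x * x + x
  y²≤x³+x = subst₂ (λ a b → a ≤ b + x) (n^2≡n*n y) (n^3≡n*n*n x)
                   (≤-trans (n≤m+∣+m-+n∣ (x ^ 3) (y ^ 2)) (+-monoʳ-≤ (x ^ 3) (<⇒≤ K<x)))

large-good-triplet : ∀ {x y k} → 17 ≤ x → GoodTriplet x y k → GoodApproximation x y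
large-good-triplet {x} {y} 17≤x (_ , _ , refl , _ , K²<x) =
  let Q , 1≤Q , Q⁶<x , x≤[1+Q]⁶ = sixth-root x 1<x
  in  good-approximation 17≤x K²<x Q⁶<x x≤[1+Q]⁶ (dirichlet {{>-nonZero (<⇒≤ 1<x)}} 1≤Q x≤y)
  where
  1<x : 1 < x
  1<x = ≤-trans (m≤m+n 2 15) 17≤x
  x≤y : x ≤ y
  x≤y = x³≤y²+K⇒x≤y (≤-<-trans (n≤n*n _) K²<x) (m≤n+∣+m-+n∣ (x ^ 3) (y ^ 2))

GoodTriplet? : ∀ x y k → Dec (GoodTriplet x y k)
GoodTriplet? x y k = 1 ≤? x ×-dec 1 ≤? y ×-dec k ℤ.≟ + (x ^ 3) ℤ.- + (y ^ 2) ×-dec ¬? (k ℤ.≟ 0ℤ) ×-dec ∣ k ∣ * ∣ k ∣ <? x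

small-good-triplets : ∀ {x y} → x < 17 → y < 71 → GoodTriplet x y (+ (x ^ 3) ℤ.- + (y ^ 2)) → x ≡ 2 × y ≡ 3
small-good-triplets x<17 y<71 =
  subst₂ Claim (toℕ-fromℕ< x<17) (toℕ-fromℕ< y<71) (table (fromℕ< x<17) (fromℕ< y<71))
  where
  Claim : ℕ → ℕ → Set
  Claim x y = GoodTriplet x y (+ (x ^ 3) ℤ.- + (y ^ 2)) → x ≡ 2 × y ≡ 3
  table : ∀ (i : Fin 17) (j : Fin 71) → Claim (toℕ i) (toℕ j)
  table = toWitness {a? = all? λ i → all? λ j →
                            GoodTriplet? (toℕ i) (toℕ j) _ →-dec (toℕ i ≟ 2 ×-dec toℕ j ≟ 3)} _

y<71 : ∀ {x y K} → x < 17 → K < x → y ^ 2 ≤ x ^ 3 + K → y < 71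
y<71 {x} {y} {K} x<17 K<x y²≤x³+K = m*m<n*n⇒m<n (begin-strict
  y * y         ≡⟨ sym (n^2≡n*n y) ⟩
  y ^ 2         ≤⟨ y²≤x³+K ⟩
  x ^ 3 + K     ≤⟨ +-mono-≤ (^-monoˡ-≤ 3 x≤16) (≤-trans (<⇒≤ K<x) x≤16) ⟩
  16 ^ 3 + 16   <⟨ m<m+n 4112 {929} (s≤s z≤n) ⟩
  71 * 71       ∎)
  where
  open ≤-Reasoning
  x≤16 : x ≤ 16
  x≤16 = ≤-pred x<17

small-good-triplet : ∀ {x y k} → x < 17 → GoodTriplet x y k → GoodApproximation x y
small-good-triplet {x} {y} x<17 good@(_ , _ , refl , _ , K²<x) =
  let x≡2 , y≡3 = small-good-triplets x<17 (y<71 x<17 (≤-<-trans (n≤n*n _) K²<x) (n≤m+∣+m-+n∣ (x ^ 3) (y ^ 2))) good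
  in  subst₂ GoodApproximation (sym x≡2) (sym y≡3) (1 , 1 , s≤s z≤n , s≤s z≤n , s≤s (s≤s z≤n) , s≤s (s≤s z≤n) , s≤s z≤n)

proposition5p4 : (x y : ℕ) (k : ℤ) → GoodTriplet x y k →
    Σ ℕ λ p → Σ ℕ λ q →
      (1 ≤ p) × (1 ≤ q) ×
      (∣ F (+ q) (+ p) (+ x) (+ y) ∣ < 8 * q + 1) ×
      (q ^ 6 < x) ×
      ((p ∸ 1) ^ 3 < x ^ 2)
proposition5p4 x y k good with x <? 17
... | yes x<17 = small-good-triplet x<17 good
... | no  x≮17 = large-good-triplet (≮⇒≥ x≮17) good
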